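{- Let $c > 1$ be an integer. For $n \ge 0$ let $a(n)$ be the number of $n$-color compositions of $n$ in which every part has color $c$, and set $a(n) = 0$ for $n \le -1$. Then $a(0)=1$, $a(1) = \cdots = a(c-1) = 0$, and $a(n) = a(n-1) + a(n-c)$ for all $n \ge c$. Moreover, for every $n \ge 1$, \[ a(n) = \sum_{m=1}^{n} \binom{n-(c-1)m-1}{m-1}, \] where $\binom{x}{k}$ is interpreted as $0$ whenever $x < k$ (in particular whenever $x<0$).
   Context: An $n$-color composition of a positive integer $n$ is a finite sequence of parts $(\kappa^{(1)}_{c_1}, \ldots, \kappa^{(r)}_{c_r})$, where $\kappa^{(1)}, \ldots, \kappa^{(r)}$ are positive integers with sum $n$ and each part $\kappa^{(j)}$ carries a color $c_j \in \{1, \ldots, \kappa^{(j)}\}$. By convention there is exactly one (empty) composition of $0$. -}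

module Defs where

open import Data.Nat using (ℕ; zero; suc; _+_; _≤_)
open import Data.Nat.Combinatorics using (_C_)
open import Data.Integer using (ℤ; +_; -[1+_])
open import Data.List using (List; map)
open import Data.Nat.ListAction using (sum)
open import Data.List.Relation.Unary.All using (All)
open import Data.Product using (Σ; proj₁)
open import Relation.Binary.PropositionalEquality using (_≡_)

record Part : Set where
  constructor part
  field
    size    : ℕ
    color   : ℕ
    1≤color : 1 ≤ color
    color≤size : color ≤ size
open Part public

NColorComp : ℕ → Set
NColorComp n = Σ (List Part) (λ ps → sum (map size ps) ≡ n)

AllColorComp : ℕ → ℕ → Set
AllColorComp c n = Σ (NColorComp n) (λ π → All (λ p → color p ≡ c) (proj₁ π))

-- Binomial coefficient with integer top argument, 0 when the top is negative
-- (and, via stdlib's _C_, 0 when top < bottom).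
binomℤ : ℤ → ℕ → ℕ
binomℤ (+ x)     k = x C k
binomℤ -[1+ _ ]  k = 0

sumFrom1 : ℕ → (ℕ → ℕ) → ℕ
sumFrom1 zero    f = 0
sumFrom1 (suc n) f = sumFrom1 n f + f (suc n)

-- Write each part of colour c as t + c with excess t ≥ 0. A composition of c + k either
-- begins with a part of excess 0, which can be deleted (leaving k), or with a larger part,
-- whose excess can be lowered by one (leaving c − 1 + k); so a(c + k) = a(c − 1 + k) + a(k).
-- With d = c − 1, the m-th summand C(n − dm − 1, m − 1) obeys Pascal's rule in the form
-- T(n + 1, m + 1) = T(n, m + 1) + T(n − d, m) for m ≥ 1, so the binomial sum satisfies the
-- same recurrence for n > c; both sequences take the values 0, …, 0, 1 on 1, …, c.
module Submission where

open import Defs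
open import Data.Nat using (ℕ; zero; suc; _+_; _*_; _∸_; _≤_; _<_; z≤n; s≤s; _<?_)
open import Data.Nat.Properties
open import Data.Nat.Combinatorics using (_C_; nCk+nC[k+1]≡[n+1]C[k+1])
open import Data.Nat.Induction using (<-rec)
open import Data.Nat.ListAction using (sum)
open import Algebra.Properties.CommutativeSemigroup +-commutativeSemigroup using (interchange)
open import Data.Integer as ℤ using (+_; _-_; _⊖_)
import Data.Integer.Properties as ℤP
open import Data.Fin using (Fin)
open import Data.Fin.Properties using (+↔⊎; cantor-schröder-bernstein)
open import Data.List using (List; []; _∷_; map)
open import Data.List.Properties using (map-∘; map-id-local)
open import Data.List.Relation.Unary.All as All using (All)
open import Data.List.Relation.Unary.All.Properties using (map⁺)
open import Data.Product using (_×_; _,_; proj₁; Σ)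
open import Data.Sum using (_⊎_; inj₁; inj₂)
open import Data.Sum.Function.Propositional using (_⊎-↔_)
open import Function using (_∘_)
open import Function.Bundles using (_↔_; Inverse; Injection; mk↔ₛ′)
open import Function.Properties.Inverse using (↔-sym; ↔-trans; ↔⇒↣)
open import Relation.Nullary using (¬_; contradiction; yes; no)
open import Relation.Binary.PropositionalEquality
open ≡-Reasoning

Fin-↔⇒≡ : ∀ {m n} → Fin m ↔ Fin n → m ≡ n
Fin-↔⇒≡ m↔n = cantor-schröder-bernstein
  (Injection.injective (↔⇒↣ m↔n)) (Injection.injective (↔⇒↣ (↔-sym m↔n)))

Fin-↔-¬⇒≡0 : ∀ {A : Set} {m} → Fin m ↔ A → ¬ A → m ≡ 0
Fin-↔-¬⇒≡0 {m = zero}  _   _  = refl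
Fin-↔-¬⇒≡0 {m = suc _} m↔A ¬A = contradiction (Inverse.to m↔A Fin.zero) ¬A

sumFrom1-suc : ∀ N f → sumFrom1 (suc N) f ≡ f 1 + sumFrom1 N (f ∘ suc)
sumFrom1-suc zero    f = +-comm 0 (f 1)
sumFrom1-suc (suc N) f = begin
  sumFrom1 (suc N) f + f (2 + N)                ≡⟨ cong (_+ f (2 + N)) (sumFrom1-suc N f) ⟩
  f 1 + sumFrom1 N (f ∘ suc) + f (2 + N)        ≡⟨ +-assoc (f 1) _ _ ⟩
  f 1 + (sumFrom1 N (f ∘ suc) + f (2 + N))      ∎

sumFrom1-cong : ∀ N {f g} → (∀ m → 1 ≤ m → f m ≡ g m) → sumFrom1 N f ≡ sumFrom1 N g
sumFrom1-cong zero    f≡g = refl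
sumFrom1-cong (suc N) f≡g = cong₂ _+_ (sumFrom1-cong N f≡g) (f≡g (suc N) (s≤s z≤n))

sumFrom1-≡0 : ∀ N {f} → (∀ m → 1 ≤ m → f m ≡ 0) → sumFrom1 N f ≡ 0
sumFrom1-≡0 zero    f≡0 = refl
sumFrom1-≡0 (suc N) f≡0 = cong₂ _+_ (sumFrom1-≡0 N f≡0) (f≡0 (suc N) (s≤s z≤n))

sumFrom1-distrib-+ : ∀ N f g → sumFrom1 N (λ m → f m + g m) ≡ sumFrom1 N f + sumFrom1 N g
sumFrom1-distrib-+ zero    f g = refl
sumFrom1-distrib-+ (suc N) f g = trans
  (cong (_+ (f (suc N) + g (suc N))) (sumFrom1-distrib-+ N f g))
  (interchange (sumFrom1 N f) (sumFrom1 N g) (f (suc N)) (g (suc N)))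

sumFrom1-vanishing-tail : ∀ j N {f} → (∀ m → N < m → f m ≡ 0) → sumFrom1 (j + N) f ≡ sumFrom1 N f
sumFrom1-vanishing-tail zero    N f≡0 = refl
sumFrom1-vanishing-tail (suc j) N f≡0 = trans
  (cong₂ _+_ (sumFrom1-vanishing-tail j N f≡0) (f≡0 (suc (j + N)) (s≤s (m≤n+m N j))))
  (+-identityʳ _)

-- binom∸ n k j = C(n − k − 1, j), and 0 when n ≤ k.
binom∸ : ℕ → ℕ → ℕ → ℕ
binom∸ zero    k       j = 0
binom∸ (suc n) zero    j = n C j
binom∸ (suc n) (suc k) j = binom∸ n k j

binomℤ-⊖≡binom∸ : ∀ n k j → binomℤ (n ⊖ suc k) j ≡ binom∸ n k j
binomℤ-⊖≡binom∸ zero    k       j = refl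
binomℤ-⊖≡binom∸ (suc n) zero    j = cong (λ x → binomℤ x j) (ℤP.⊖-≥ (s≤s z≤n))
binomℤ-⊖≡binom∸ (suc n) (suc k) j =
  trans (cong (λ x → binomℤ x j) (ℤP.[1+m]⊖[1+n]≡m⊖n n (suc k))) (binomℤ-⊖≡binom∸ n k j)

binomℤ-[n-k-1]≡binom∸ : ∀ n k j → binomℤ (+ n - + k - + 1) j ≡ binom∸ n k j
binomℤ-[n-k-1]≡binom∸ n k j = trans (cong (λ x → binomℤ x j) n-k-1≡n⊖1+k) (binomℤ-⊖≡binom∸ n k j)
  where
  n-k-1≡n⊖1+k : + n - + k - + 1 ≡ n ⊖ suc k
  n-k-1≡n⊖1+k = begin
    + n - + k - + 1               ≡⟨ ℤP.+-assoc (+ n) (ℤ.- + k) (ℤ.- + 1) ⟩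
    + n ℤ.+ (ℤ.- + k ℤ.+ ℤ.- + 1) ≡⟨ cong (ℤ._+_ (+ n)) (ℤP.neg-distrib-+ (+ k) (+ 1)) ⟨
    + n - + (k + 1)               ≡⟨ cong (λ x → + n - + x) (+-comm k 1) ⟩
    + n - + suc k                 ≡⟨ ℤP.m-n≡m⊖n n (suc k) ⟩
    n ⊖ suc k                     ∎

binom∸-≤ : ∀ {n k} j → n ≤ k → binom∸ n k j ≡ 0
binom∸-≤ {zero}  j _         = refl
binom∸-≤ {suc n} j (s≤s n≤k) = binom∸-≤ j n≤k

binom∸-< : ∀ {n k} j → k < n → binom∸ n k j ≡ (n ∸ suc k) C j
binom∸-< {suc n} {zero}  j _         = refl
binom∸-< {suc n} {suc k} j (s≤s k<n) = binom∸-< j k<n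

binom∸-pascal : ∀ n k j → binom∸ (suc n) k (suc j) ≡ binom∸ n k (suc j) + binom∸ n k j
binom∸-pascal zero    zero    j = refl
binom∸-pascal zero    (suc k) j = refl
binom∸-pascal (suc n) zero    j =
  trans (sym (nCk+nC[k+1]≡[n+1]C[k+1] n j)) (+-comm (n C j) (n C suc j))
binom∸-pascal (suc n) (suc k) j = binom∸-pascal n k j

binom∸-+ : ∀ d n k j → binom∸ (d + n) (d + k) j ≡ binom∸ n k j
binom∸-+ zero    n k j = refl
binom∸-+ (suc d) n k j = binom∸-+ d n k j

part-≡ : ∀ {p q} → size p ≡ size q → color p ≡ color q → p ≡ q
part-≡ {part s k _ _} {part .s .k _ _} refl refl =
  cong₂ (part s k) (≤-irrelevant _ _) (≤-irrelevant _ _)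

AllColorComp-≡ : ∀ {c n} {x y : AllColorComp c n} → proj₁ (proj₁ x) ≡ proj₁ (proj₁ y) → x ≡ y
AllColorComp-≡ {x = (ps , _) , _} {y = (.ps , _) , _} refl =
  cong₂ (λ Σ≡n colours → (ps , Σ≡n) , colours) (≡-irrelevant _ _) (All.irrelevant ≡-irrelevant _ _)

-- Compositions of n into parts of size at least c, the part t + c being recorded as t.
ExcessComp : ℕ → ℕ → Set
ExcessComp c n = Σ (List ℕ) λ ts → sum (map (_+ c) ts) ≡ n

ExcessComp-≡ : ∀ {c n} {x y : ExcessComp c n} → proj₁ x ≡ proj₁ y → x ≡ y
ExcessComp-≡ {x = ts , _} {y = .ts , _} refl = cong (ts ,_) (≡-irrelevant _ _)

ExcessComp-∷-≥ : ∀ {c n} t ts → sum (map (_+ c) (t ∷ ts)) ≡ n → c ≤ n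
ExcessComp-∷-≥ {c} t ts refl = ≤-trans (m≤n+m c t) (m≤m+n (t + c) _)

ExcessComp-empty : ∀ {c n} → 1 ≤ n → n < c → ¬ ExcessComp c n
ExcessComp-empty ()  _   ([] , refl)
ExcessComp-empty 1≤n n<c (t ∷ ts , Σ≡n) = <⇒≱ n<c (ExcessComp-∷-≥ t ts Σ≡n)

module _ {c : ℕ} (1≤c : 1 ≤ c) where

  colourPart : ℕ → Part
  colourPart t = part (t + c) c 1≤c (m≤n+m c t)

  excess : Part → ℕ
  excess p = size p ∸ c

  colourPart-excess : ∀ {p} → color p ≡ c → colourPart (excess p) ≡ p
  colourPart-excess {part s _ _ c≤s} refl = part-≡ (m∸n+n≡m c≤s) refl

  map-colourPart-excess : ∀ {ps} → All (λ p → color p ≡ c) ps → map colourPart (map excess ps) ≡ ps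
  map-colourPart-excess {ps} colours =
    trans (sym (map-∘ ps)) (map-id-local (All.map colourPart-excess colours))

  AllColorComp↔ExcessComp : ∀ {n} → AllColorComp c n ↔ ExcessComp c n
  AllColorComp↔ExcessComp {n} = mk↔ₛ′ toExcess fromExcess to∘from from∘to
    where
    toExcess : AllColorComp c n → ExcessComp c n
    toExcess ((ps , Σps≡n) , colours) = map excess ps , (begin
      sum (map (_+ c) (map excess ps))                ≡⟨ cong sum (map-∘ (map excess ps)) ⟩
      sum (map size (map colourPart (map excess ps))) ≡⟨ cong (sum ∘ map size) (map-colourPart-excess colours) ⟩
      sum (map size ps)                               ≡⟨ Σps≡n ⟩
      n                                               ∎)

    fromExcess : ExcessComp c n → AllColorComp c n
    fromExcess (ts , Σts≡n) =
      (map colourPart ts , trans (cong sum (sym (map-∘ ts))) Σts≡n) , map⁺ (All.universal (λ _ → refl) ts)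

    to∘from : ∀ x → toExcess (fromExcess x) ≡ x
    to∘from (ts , _) = ExcessComp-≡
      (trans (sym (map-∘ ts)) (map-id-local (All.universal (λ t → m+n∸n≡m t c) ts)))

    from∘to : ∀ x → fromExcess (toExcess x) ≡ x
    from∘to (_ , colours) = AllColorComp-≡ (map-colourPart-excess colours)

  ExcessComp-0↔Fin1 : ExcessComp c 0 ↔ Fin 1
  ExcessComp-0↔Fin1 = mk↔ₛ′ (λ _ → Fin.zero) (λ _ → [] , refl) (λ { Fin.zero → refl ; (Fin.suc ()) }) only-empty
    where
    only-empty : ∀ x → ([] , refl) ≡ x
    only-empty ([] , refl)      = refl
    only-empty (t ∷ ts , Σ≡0) = contradiction (ExcessComp-∷-≥ t ts Σ≡0) (<⇒≱ 1≤c)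

module _ (e : ℕ) where

  private
    d c : ℕ
    d = suc e
    c = suc d

  ExcessComp-split : ∀ k → ExcessComp c (c + k) ↔ (ExcessComp c (d + k) ⊎ ExcessComp c k)
  ExcessComp-split k = mk↔ₛ′ peel glue peel∘glue glue∘peel
    where
    peel : ExcessComp c (c + k) → ExcessComp c (d + k) ⊎ ExcessComp c k
    peel ([] , ())
    peel (zero  ∷ ts , Σ≡c+k) = inj₂ (ts , +-cancelˡ-≡ c _ _ Σ≡c+k)
    peel (suc t ∷ ts , Σ≡c+k) = inj₁ (t ∷ ts , suc-injective Σ≡c+k)

    glue : ExcessComp c (d + k) ⊎ ExcessComp c k → ExcessComp c (c + k)
    glue (inj₁ ([] , ()))
    glue (inj₁ (t ∷ ts , Σ≡d+k)) = suc t ∷ ts , cong suc Σ≡d+k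
    glue (inj₂ (ts , Σ≡k))       = zero ∷ ts , cong (_+_ c) Σ≡k

    peel∘glue : ∀ y → peel (glue y) ≡ y
    peel∘glue (inj₁ (_ ∷ _ , _)) = cong inj₁ (ExcessComp-≡ refl)
    peel∘glue (inj₂ _)           = cong inj₂ (ExcessComp-≡ refl)

    glue∘peel : ∀ x → glue (peel x) ≡ x
    glue∘peel (zero  ∷ _ , _) = ExcessComp-≡ refl
    glue∘peel (suc _ ∷ _ , _) = ExcessComp-≡ refl

  Recurrent : (ℕ → ℕ) → Set
  Recurrent f = ∀ k → f (c + k) ≡ f (d + k) + f k

  recurrent-unique : ∀ {f g} → (∀ n → n < c → f n ≡ g n) → Recurrent f → Recurrent g → ∀ n → f n ≡ g n
  recurrent-unique {f} {g} f≡g<c rec-f rec-g = <-rec (λ n → f n ≡ g n) step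
    where
    step : ∀ n → (∀ {m} → m < n → f m ≡ g m) → f n ≡ g n
    step n f≡g<n with n <? c
    ... | yes n<c = f≡g<c n n<c
    ... | no n≮c with k , refl ← m≤n⇒∃[o]m+o≡n (≮⇒≥ n≮c) = begin
      f (c + k)         ≡⟨ rec-f k ⟩
      f (d + k) + f k   ≡⟨ cong₂ _+_ (f≡g<n (n<1+n (d + k))) (f≡g<n (m<n+m k (s≤s z≤n))) ⟩
      g (d + k) + g k   ≡⟨ rec-g k ⟨
      g (c + k)         ∎

  recurrent-∘suc : ∀ {f} → (∀ k → f (c + suc k) ≡ f (d + suc k) + f (suc k)) → Recurrent (f ∘ suc)
  recurrent-∘suc {f} rec k = begin
    f (suc (c + k))           ≡⟨ cong f (+-suc c k) ⟨
    f (c + suc k)             ≡⟨ rec k ⟩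
    f (d + suc k) + f (suc k) ≡⟨ cong (λ x → f x + f (suc k)) (+-suc d k) ⟩
    f (suc (d + k)) + f (suc k) ∎

  recurrent-∸ : ∀ {f} → Recurrent f → ∀ n → c ≤ n → f n ≡ f (n ∸ 1) + f (n ∸ c)
  recurrent-∸ {f} rec n c≤n with k , refl ← m≤n⇒∃[o]m+o≡n c≤n =
    trans (rec k) (cong (λ x → f (d + k) + f x) (sym (m+n∸m≡n c k)))

  module Counting {a : ℕ → ℕ} (a↔ : ∀ n → Fin (a n) ↔ AllColorComp c n) where

    a↔ExcessComp : ∀ n → Fin (a n) ↔ ExcessComp c n
    a↔ExcessComp n = ↔-trans (a↔ n) (AllColorComp↔ExcessComp (s≤s z≤n))

    a-zero : a 0 ≡ 1
    a-zero = Fin-↔⇒≡ (↔-trans (a↔ExcessComp 0) (ExcessComp-0↔Fin1 (s≤s z≤n)))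

    a-small : ∀ n → 1 ≤ n → n ≤ d → a n ≡ 0
    a-small n 1≤n n≤d = Fin-↔-¬⇒≡0 (a↔ExcessComp n) (ExcessComp-empty 1≤n (s≤s n≤d))

    a-recurrent : Recurrent a
    a-recurrent k = Fin-↔⇒≡
      (↔-trans (a↔ExcessComp (c + k))
      (↔-trans (ExcessComp-split k)
      (↔-trans (↔-sym (a↔ExcessComp (d + k)) ⊎-↔ ↔-sym (a↔ExcessComp k))
               (↔-sym +↔⊎))))

    a-c : a c ≡ 1
    a-c = begin
      a c             ≡⟨ cong a (+-identityʳ c) ⟨
      a (c + 0)       ≡⟨ a-recurrent 0 ⟩
      a (d + 0) + a 0 ≡⟨ cong₂ _+_ (a-small (d + 0) (s≤s z≤n) (≤-reflexive (+-identityʳ d))) a-zero ⟩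
      1               ∎

  T : ℕ → ℕ → ℕ
  T n m = binom∸ n (d * m) (m ∸ 1)

  S : ℕ → ℕ
  S n = sumFrom1 n (T n)

  S≡binomℤ-sum : ∀ n → S n ≡ sumFrom1 n (λ m → binomℤ (+ n - + (d * m) - + 1) (m ∸ 1))
  S≡binomℤ-sum n = sumFrom1-cong n λ m _ → sym (binomℤ-[n-k-1]≡binom∸ n (d * m) (m ∸ 1))

  T-vanish : ∀ {n m} → n ≤ d * m → T n m ≡ 0
  T-vanish {m = m} = binom∸-≤ (m ∸ 1)

  T-vanish-< : ∀ {n m} → n < m → T n m ≡ 0
  T-vanish-< {m = m} n<m = T-vanish (≤-trans (<⇒≤ n<m) (m≤n*m m d))

  T-one : ∀ {n} → d < n → T n 1 ≡ 1
  T-one {n} d<n = trans (cong (λ k → binom∸ n k 0) (*-identityʳ d)) (binom∸-< 0 d<n)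

  T-pascal : ∀ n m → T (suc (d + n)) (2 + m) ≡ T (d + n) (2 + m) + T n (suc m)
  T-pascal n m = begin
    binom∸ (suc (d + n)) (d * (2 + m)) (suc m)
      ≡⟨ binom∸-pascal (d + n) (d * (2 + m)) m ⟩
    binom∸ (d + n) (d * (2 + m)) (suc m) + binom∸ (d + n) (d * (2 + m)) m
      ≡⟨ cong (λ k → binom∸ (d + n) (d * (2 + m)) (suc m) + binom∸ (d + n) k m) (*-suc d (suc m)) ⟩
    binom∸ (d + n) (d * (2 + m)) (suc m) + binom∸ (d + n) (d + d * suc m) m
      ≡⟨ cong (_+_ (binom∸ (d + n) (d * (2 + m)) (suc m))) (binom∸-+ d n (d * suc m) m) ⟩
    binom∸ (d + n) (d * (2 + m)) (suc m) + binom∸ n (d * suc m) m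
      ∎

  S-small : ∀ {n} → n ≤ d → S n ≡ 0
  S-small {n} n≤d = sumFrom1-≡0 n λ { (suc m) _ → T-vanish (≤-trans n≤d (m≤m*n d (suc m))) }

  S-c : S c ≡ 1
  S-c = trans (sumFrom1-suc d (T c)) (cong₂ _+_ (T-one ≤-refl) (sumFrom1-≡0 d tail≡0))
    where
    tail≡0 : ∀ m → 1 ≤ m → T c (suc m) ≡ 0
    tail≡0 (suc m) _ = T-vanish (s≤s (s≤s (≤-trans (m≤m*n e (2 + m)) (m≤n+m _ m))))

  S-recurrence : ∀ k → S (c + suc k) ≡ S (d + suc k) + S (suc k)
  S-recurrence k = begin
    S (suc N)
      ≡⟨ sumFrom1-suc N (T (suc N)) ⟩
    T (suc N) 1 + sumFrom1 N (λ m → T (suc N) (suc m))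
      ≡⟨ cong₂ _+_ (trans (T-one (m<n⇒m<1+n d<N)) (sym (T-one d<N)))
                   (sumFrom1-cong N λ { (suc m) _ → T-pascal n m }) ⟩
    T N 1 + sumFrom1 N (λ m → T N (suc m) + T n m)
      ≡⟨ cong (_+_ (T N 1)) (sumFrom1-distrib-+ N _ (T n)) ⟩
    T N 1 + (sumFrom1 N (λ m → T N (suc m)) + sumFrom1 N (T n))
      ≡⟨ +-assoc (T N 1) _ _ ⟨
    (T N 1 + sumFrom1 N (λ m → T N (suc m))) + sumFrom1 N (T n)
      ≡⟨ cong₂ _+_ (sym (sumFrom1-suc N (T N))) (sumFrom1-vanishing-tail d n (λ _ → T-vanish-<)) ⟩
    (S N + T N (suc N)) + S n
      ≡⟨ cong (λ x → S N + x + S n) (T-vanish-< (n<1+n N)) ⟩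
    (S N + 0) + S n
      ≡⟨ cong (_+ S n) (+-identityʳ (S N)) ⟩
    S N + S n
      ∎
    where
    n N : ℕ
    n = suc k
    N = d + n
    d<N : d < N
    d<N = m<m+n d (s≤s z≤n)

proposition4 : (c : ℕ) → 1 < c → (a : ℕ → ℕ) → (∀ n → Fin (a n) ↔ AllColorComp c n) →
                 (a 0 ≡ 1)
                 × (∀ n → 1 ≤ n → n ≤ c ∸ 1 → a n ≡ 0)
                 × (∀ n → c ≤ n → a n ≡ a (n ∸ 1) + a (n ∸ c))
                 × (∀ n → 1 ≤ n → a n ≡ sumFrom1 n (λ m → binomℤ (+ n - + ((c ∸ 1) * m) - + 1) (m ∸ 1)))
proposition4 zero          ()          _ _
proposition4 (suc zero)    (s≤s ())    _ _
proposition4 (suc (suc e)) _           a a↔ =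
  a-zero , a-small , recurrent-∸ e a-recurrent , a≡binomℤ-sum
  where
  open Counting e a↔

  a≡S-on-[1,c] : ∀ n → n < suc (suc e) → a (suc n) ≡ S e (suc n)
  a≡S-on-[1,c] n (s≤s n≤d) with m≤n⇒m<n∨m≡n n≤d
  ... | inj₁ n<d  = trans (a-small (suc n) (s≤s z≤n) n<d) (sym (S-small e n<d))
  ... | inj₂ refl = trans a-c (sym (S-c e))

  a≡S : ∀ n → a (suc n) ≡ S e (suc n)
  a≡S = recurrent-unique e a≡S-on-[1,c]
    (recurrent-∘suc e {a} (a-recurrent ∘ suc)) (recurrent-∘suc e {S e} (S-recurrence e))

  a≡binomℤ-sum : ∀ n → 1 ≤ n → a n ≡ sumFrom1 n (λ m → binomℤ (+ n - + (suc e * m) - + 1) (m ∸ 1))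
  a≡binomℤ-sum (suc n) _ = trans (a≡S n) (S≡binomℤ-sum e (suc n))
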